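{- Let $p>3$ be a prime, $a,m\in\mathbb Z_p$ with $m\not\equiv 0\pmod p$ and $a\not\equiv 0,\pm1,-2\pmod p$. Put $c_k=\binom ak\binom{ -1-a}k\binom{2k}k$. Then $$\sum_{k=0}^{p-3}\frac{c_k}{m^k(k+2)}\equiv\frac{4-m}{6(a-1)(a+2)}\sum_{k=0}^{p-1}\frac{kc_k}{m^k}+\frac{m-6}{6(a-1)(a+2)}\sum_{k=0}^{p-1}\frac{c_k}{m^k}+\frac{2a(a+1)-m}{6(a-1)(a+2)}\sum_{k=0}^{p-2}\frac{c_k}{m^k(k+1)}\pmod{p^3}.$$
   Context: $\mathbb Z_p$ denotes the ring of rational numbers whose denominators are not divisible by $p$; congruences are in $\mathbb Z_p$. Generalized binomial coefficients: $\binom a0=1$, $\binom ak=\frac{a(a-1)\cdots(a-k+1)}{k!}$ for $k\ge1$. -}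

module Defs where

open import Data.Nat as ℕ using (ℕ; zero; suc; _^_)
open import Data.Nat.Divisibility using (_∣_)
open import Data.Nat.Combinatorics using (_C_)
open import Data.Integer as ℤ using (ℤ; +_)
open import Data.Rational as ℚ using (ℚ; 0ℚ; 1ℚ; _+_; _-_; _*_; ↧ₙ_; 1/_; _≟_; ≢-nonZero)
open import Data.Product using (∃; _×_)
open import Relation.Nullary using (¬_; yes; no)
open import Relation.Binary.PropositionalEquality using (_≡_)

ℕ→ℚ : ℕ → ℚ
ℕ→ℚ n = + n ℚ./ 1

InZp : ℕ → ℚ → Set
InZp p q = ¬ (p ∣ ↧ₙ q)

CongMod : (p n : ℕ) → ℚ → ℚ → Set
CongMod p n x y = ∃ λ z → InZp p z × (x - y ≡ ℕ→ℚ (p ^ n) * z)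

-- total inverse (1/0 := 0); only ever applied to nonzero arguments below
inv : ℚ → ℚ
inv q with q ≟ 0ℚ
... | yes _ = 0ℚ
... | no q≢0 = 1/_ q {{≢-nonZero q≢0}}

binom : ℚ → ℕ → ℚ
binom a zero = 1ℚ
binom a (suc k) = binom a k * (a - ℕ→ℚ k) * (+ 1 ℚ./ suc k)

sumTo : ℕ → (ℕ → ℚ) → ℚ
sumTo zero f = f zero
sumTo (suc n) f = sumTo n f + f (suc n)

c : ℚ → ℕ → ℚ
c a k = binom a k * binom (ℚ.- 1ℚ - a) k * ℕ→ℚ ((2 ℕ.* k) C k)

_^ℚ_ : ℚ → ℕ → ℚ
q ^ℚ zero = 1ℚ
q ^ℚ suc n = q * (q ^ℚ n)

-- Write tₖ = cₖ/mᵏ. The only property of the summands that is used is the recurrence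
--   m (k+1)³ tₖ₊₁ = 2(2k+1)(a-k)(-1-a-k) tₖ,
-- under which, for p = n + 3, the product of 6(a-1)(a+2) with (left side - right side)
-- telescopes exactly in ℚ to the boundary term
--   tₙ₊₂ (m(3n²+9n+7)/(2n+3) - 2(2n+1)) - 6n tₙ₊₁.
-- For k = p-2, p-1 each of the three factors of cₖ = binom(a,k) binom(-1-a,k) binom(2k,k) is
-- divisible by p: as a ≢ 0, ±1, -2, both a and -1-a are congruent to residues j < p-2, so
-- binom(x,k) contains the factor x - j; and p divides binom(2k,k) since k < p ≤ 2k.
-- Hence the boundary term vanishes mod p³, while 6(a-1)(a+2), m and 2n+3 = 2p-3 are p-adic units.
{-# OPTIONS --safe #-}
module Submission where

open import Defs
open import Data.Nat as ℕ using (ℕ; zero; suc; _<_; _≤_; _∸_; _^_; _!; s≤s)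
import Data.Nat.Properties as ℕP
open import Data.Nat.Combinatorics using (_C_; nCk≡n!/k![n-k]!; k![n∸k]!∣n!)
open import Data.Nat.DivMod using (m/n*n≡m)
open import Data.Integer as ℤ using (ℤ; +_; -[1+_])
import Data.Integer.Properties as ℤP
import Data.Integer.GCD as ℤGCD
open import Data.Rational as ℚ using (ℚ; mkℚ; 0ℚ; 1ℚ; _+_; _-_; _*_; ↥_; ↧_; _≟_)
import Data.Rational.Properties as ℚP
import Data.Rational.Unnormalised as ℚᵘ
import Data.Rational.Unnormalised.Properties as ℚᵘP
open import Data.Nat.Divisibility
  using (_∣_; _∤_; divides; _∣?_; _∣0; ∣1⇒≡1; ∣-trans; ∣-refl; ∣⇒≤; m∣m*n; ∣m+n∣m⇒∣n; m≤n⇒m!∣n!)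
open import Data.Nat.Primality using (Prime; euclidsLemma; prime⇒irreducible; prime⇒nonTrivial)
import Data.Nat.Coprimality as Coprime
import Data.Nat.GCD as ℕGCD
import Data.Integer.DivMod as ℤDivMod
import Data.Integer.Divisibility.Signed as ℤDiv
open import Data.Product using (∃; _×_; _,_)
open import Data.Sum using (inj₁; inj₂; [_,_]′)
open import Data.Empty using (⊥-elim)
open import Relation.Nullary using (¬_; yes; no)
open import Relation.Binary.PropositionalEquality
import Data.Nat.Solver
import Data.Integer.Solver
import Data.Rational.Solver
module ℕ-Solver = Data.Nat.Solver.+-*-Solver
module ℤ-Solver = Data.Integer.Solver.+-*-Solver
module ℚ-Solver = Data.Rational.Solver.+-*-Solver

private
  # : ∀ {k} → ℕ → ℚ-Solver.Polynomial k
  # n = ℚ-Solver.con (ℕ→ℚ n)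

-- Rational arithmetic

ℤ→ℚ : ℤ → ℚ
ℤ→ℚ z = z ℚ./ 1

private
  toℚᵘ-ℤ→ℚ : ∀ z → ℚ.toℚᵘ (ℤ→ℚ z) ℚᵘ.≃ ℚᵘ.mkℚᵘ z 0
  toℚᵘ-ℤ→ℚ z = ℚP.toℚᵘ-fromℚᵘ (ℚᵘ.mkℚᵘ z 0)

ℤ→ℚ-+ : ∀ x y → ℤ→ℚ (x ℤ.+ y) ≡ ℤ→ℚ x + ℤ→ℚ y
ℤ→ℚ-+ x y = ℚP.toℚᵘ-injective (begin
  ℚ.toℚᵘ (ℤ→ℚ (x ℤ.+ y))               ≈⟨ toℚᵘ-ℤ→ℚ (x ℤ.+ y) ⟩
  ℚᵘ.mkℚᵘ (x ℤ.+ y) 0                    ≈⟨ ℚᵘ.*≡* (solve 2 (λ x y → (x :+ y) :* con (+ 1) := (x :* con (+ 1) :+ y :* con (+ 1)) :* con (+ 1)) refl x y) ⟩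
  ℚᵘ.mkℚᵘ x 0 ℚᵘ.+ ℚᵘ.mkℚᵘ y 0          ≈⟨ ℚᵘP.+-cong (ℚᵘP.≃-sym (toℚᵘ-ℤ→ℚ x)) (ℚᵘP.≃-sym (toℚᵘ-ℤ→ℚ y)) ⟩
  ℚ.toℚᵘ (ℤ→ℚ x) ℚᵘ.+ ℚ.toℚᵘ (ℤ→ℚ y)  ≈⟨ ℚᵘP.≃-sym (ℚP.toℚᵘ-homo-+ (ℤ→ℚ x) (ℤ→ℚ y)) ⟩
  ℚ.toℚᵘ (ℤ→ℚ x + ℤ→ℚ y)               ∎)
  where open ℚᵘP.≃-Reasoning
        open ℤ-Solver

ℤ→ℚ-* : ∀ x y → ℤ→ℚ (x ℤ.* y) ≡ ℤ→ℚ x * ℤ→ℚ y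
ℤ→ℚ-* x y = ℚP.toℚᵘ-injective (begin
  ℚ.toℚᵘ (ℤ→ℚ (x ℤ.* y))               ≈⟨ toℚᵘ-ℤ→ℚ (x ℤ.* y) ⟩
  ℚᵘ.mkℚᵘ (x ℤ.* y) 0                    ≈⟨ ℚᵘ.*≡* refl ⟩
  ℚᵘ.mkℚᵘ x 0 ℚᵘ.* ℚᵘ.mkℚᵘ y 0          ≈⟨ ℚᵘP.*-cong (ℚᵘP.≃-sym (toℚᵘ-ℤ→ℚ x)) (ℚᵘP.≃-sym (toℚᵘ-ℤ→ℚ y)) ⟩
  ℚ.toℚᵘ (ℤ→ℚ x) ℚᵘ.* ℚ.toℚᵘ (ℤ→ℚ y)  ≈⟨ ℚᵘP.≃-sym (ℚP.toℚᵘ-homo-* (ℤ→ℚ x) (ℤ→ℚ y)) ⟩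
  ℚ.toℚᵘ (ℤ→ℚ x * ℤ→ℚ y)               ∎)
  where open ℚᵘP.≃-Reasoning

ℤ→ℚ-neg : ∀ x → ℤ→ℚ (ℤ.- x) ≡ ℚ.- ℤ→ℚ x
ℤ→ℚ-neg x = ℚP.toℚᵘ-injective (begin
  ℚ.toℚᵘ (ℤ→ℚ (ℤ.- x))     ≈⟨ toℚᵘ-ℤ→ℚ (ℤ.- x) ⟩
  ℚᵘ.- ℚᵘ.mkℚᵘ x 0          ≈⟨ ℚᵘP.-‿cong (ℚᵘP.≃-sym (toℚᵘ-ℤ→ℚ x)) ⟩
  ℚᵘ.- ℚ.toℚᵘ (ℤ→ℚ x)      ≈⟨ ℚᵘP.≃-sym (ℚP.toℚᵘ-homo‿- (ℤ→ℚ x)) ⟩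
  ℚ.toℚᵘ (ℚ.- ℤ→ℚ x)       ∎)
  where open ℚᵘP.≃-Reasoning

ℤ→ℚ-- : ∀ x y → ℤ→ℚ (x ℤ.- y) ≡ ℤ→ℚ x - ℤ→ℚ y
ℤ→ℚ-- x y = trans (ℤ→ℚ-+ x (ℤ.- y)) (cong (λ z → ℤ→ℚ x + z) (ℤ→ℚ-neg y))

↥-ℤ→ℚ : ∀ z → ↥ ℤ→ℚ z ≡ z
↥-ℤ→ℚ z = begin
  ↥ ℤ→ℚ z                         ≡⟨ ℤP.*-identityʳ (↥ ℤ→ℚ z) ⟨
  ↥ ℤ→ℚ z ℤ.* + 1                 ≡⟨ cong (↥ ℤ→ℚ z ℤ.*_) (ℤGCD.gcd-zeroʳ z) ⟨
  ↥ ℤ→ℚ z ℤ.* ℤGCD.gcd z (+ 1)   ≡⟨ ℚP.↥-/ z 1 ⟩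
  z                               ∎
  where open ≡-Reasoning

ℤ→ℚ-injective : ∀ {x y} → ℤ→ℚ x ≡ ℤ→ℚ y → x ≡ y
ℤ→ℚ-injective {x} {y} eq = trans (sym (↥-ℤ→ℚ x)) (trans (cong ↥_ eq) (↥-ℤ→ℚ y))

ℤ→ℚ-*-/ : ∀ n d → ℤ→ℚ (+ suc d) * (n ℚ./ suc d) ≡ ℤ→ℚ n
ℤ→ℚ-*-/ n d = ℚP.toℚᵘ-injective (begin
  ℚ.toℚᵘ (ℤ→ℚ (+ suc d) * (n ℚ./ suc d))              ≈⟨ ℚP.toℚᵘ-homo-* (ℤ→ℚ (+ suc d)) (n ℚ./ suc d) ⟩
  ℚ.toℚᵘ (ℤ→ℚ (+ suc d)) ℚᵘ.* ℚ.toℚᵘ (n ℚ./ suc d)  ≈⟨ ℚᵘP.*-cong (toℚᵘ-ℤ→ℚ (+ suc d)) (ℚP.toℚᵘ-fromℚᵘ (ℚᵘ.mkℚᵘ n d)) ⟩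
  ℚᵘ.mkℚᵘ (+ suc d) 0 ℚᵘ.* ℚᵘ.mkℚᵘ n d                ≈⟨ ℚᵘ.*≡* (trans (solve 2 (λ D n → (D :* n) :* con (+ 1) := n :* D) refl (+ suc d) n)
                                                                       (cong (λ x → n ℤ.* + suc x) (sym (ℕP.+-identityʳ d)))) ⟩
  ℚᵘ.mkℚᵘ n 0                                           ≈⟨ ℚᵘP.≃-sym (toℚᵘ-ℤ→ℚ n) ⟩
  ℚ.toℚᵘ (ℤ→ℚ n)                                       ∎)
  where open ℚᵘP.≃-Reasoning
        open ℤ-Solver

↧*≡↥ : ∀ q → ℤ→ℚ (↧ q) * q ≡ ℤ→ℚ (↥ q)
↧*≡↥ q@(mkℚ n d _) = trans (cong (ℤ→ℚ (+ suc d) *_) (sym (ℚP.↥p/↧p≡p q))) (ℤ→ℚ-*-/ n d)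

ℕ→ℚ-+ : ∀ m n → ℕ→ℚ (m ℕ.+ n) ≡ ℕ→ℚ m + ℕ→ℚ n
ℕ→ℚ-+ m n = trans (cong ℤ→ℚ (ℤP.pos-+ m n)) (ℤ→ℚ-+ (+ m) (+ n))

ℕ→ℚ-* : ∀ m n → ℕ→ℚ (m ℕ.* n) ≡ ℕ→ℚ m * ℕ→ℚ n
ℕ→ℚ-* m n = trans (cong ℤ→ℚ (ℤP.pos-* m n)) (ℤ→ℚ-* (+ m) (+ n))

ℕ→ℚ-suc : ∀ n → ℕ→ℚ (suc n) ≡ 1ℚ + ℕ→ℚ n
ℕ→ℚ-suc = ℕ→ℚ-+ 1

ℕ→ℚ-suc≢0 : ∀ n → ℕ→ℚ (suc n) ≢ 0ℚ
ℕ→ℚ-suc≢0 n eq with ℤ→ℚ-injective {+ suc n} {+ 0} eq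
... | ()

*-inv : ∀ {x} → x ≢ 0ℚ → x * inv x ≡ 1ℚ
*-inv {x} x≢0 with x ≟ 0ℚ
... | yes x≡0 = ⊥-elim (x≢0 x≡0)
... | no  x≢0 = ℚP.*-inverseʳ x {{ℚ.≢-nonZero x≢0}}

*-≢0 : ∀ {x y} → x ≢ 0ℚ → y ≢ 0ℚ → x * y ≢ 0ℚ
*-≢0 {x} {y} x≢0 y≢0 xy≡0 = y≢0 (begin
  y                 ≡⟨ ℚP.*-identityˡ y ⟨
  1ℚ * y            ≡⟨ cong (_* y) (trans (ℚP.*-comm (inv x) x) (*-inv x≢0)) ⟨
  inv x * x * y     ≡⟨ ℚP.*-assoc (inv x) x y ⟩
  inv x * (x * y)   ≡⟨ cong (inv x *_) xy≡0 ⟩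
  inv x * 0ℚ        ≡⟨ ℚP.*-zeroʳ (inv x) ⟩
  0ℚ                ∎)
  where open ≡-Reasoning

inv-unique : ∀ {x y} → x * y ≡ 1ℚ → inv x ≡ y
inv-unique {x} {y} xy≡1 = begin
  inv x               ≡⟨ ℚP.*-identityʳ (inv x) ⟨
  inv x * 1ℚ          ≡⟨ cong (inv x *_) xy≡1 ⟨
  inv x * (x * y)     ≡⟨ ℚP.*-assoc (inv x) x y ⟨
  inv x * x * y       ≡⟨ cong (_* y) (trans (ℚP.*-comm (inv x) x) (*-inv x≢0)) ⟩
  1ℚ * y              ≡⟨ ℚP.*-identityˡ y ⟩
  y                   ∎
  where
  open ≡-Reasoning
  x≢0 : x ≢ 0ℚ
  x≢0 x≡0 = ℚP.1≢0 (trans (sym xy≡1) (trans (cong (_* y) x≡0) (ℚP.*-zeroˡ y)))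

inv-* : ∀ {x y} → x ≢ 0ℚ → y ≢ 0ℚ → inv (x * y) ≡ inv x * inv y
inv-* {x} {y} x≢0 y≢0 = inv-unique {x * y} (begin
  x * y * (inv x * inv y)       ≡⟨ solve 4 (λ x y x⁻¹ y⁻¹ → x :* y :* (x⁻¹ :* y⁻¹) := (x :* x⁻¹) :* (y :* y⁻¹)) refl x y (inv x) (inv y) ⟩
  (x * inv x) * (y * inv y)     ≡⟨ cong₂ _*_ (*-inv x≢0) (*-inv y≢0) ⟩
  1ℚ                            ∎)
  where open ≡-Reasoning
        open ℚ-Solver

*-diff≡0 : ∀ z {x y} → x ≡ y → z * (x - y) ≡ 0ℚ
*-diff≡0 z {x} refl = trans (cong (z *_) (ℚP.+-inverseʳ x)) (ℚP.*-zeroʳ z)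

ℕ→ℚ-3+2n : ∀ n → ℕ→ℚ (3 ℕ.+ 2 ℕ.* n) ≡ ℕ→ℚ 2 * ℕ→ℚ n + ℕ→ℚ 3
ℕ→ℚ-3+2n n = begin
  ℕ→ℚ (3 ℕ.+ 2 ℕ.* n)           ≡⟨ ℕ→ℚ-+ 3 (2 ℕ.* n) ⟩
  ℕ→ℚ 3 + ℕ→ℚ (2 ℕ.* n)         ≡⟨ cong (λ x → ℕ→ℚ 3 + x) (ℕ→ℚ-* 2 n) ⟩
  ℕ→ℚ 3 + ℕ→ℚ 2 * ℕ→ℚ n         ≡⟨ ℚP.+-comm (ℕ→ℚ 3) (ℕ→ℚ 2 * ℕ→ℚ n) ⟩
  ℕ→ℚ 2 * ℕ→ℚ n + ℕ→ℚ 3         ∎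
  where open ≡-Reasoning

2n+3≢0 : ∀ n → ℕ→ℚ 2 * ℕ→ℚ n + ℕ→ℚ 3 ≢ 0ℚ
2n+3≢0 n = subst (_≢ 0ℚ) (ℕ→ℚ-3+2n n) (ℕ→ℚ-suc≢0 (2 ℕ.+ 2 ℕ.* n))

sumTo-cong : ∀ n {f g : ℕ → ℚ} → (∀ k → f k ≡ g k) → sumTo n f ≡ sumTo n g
sumTo-cong zero    f≗g = f≗g 0
sumTo-cong (suc n) f≗g = cong₂ _+_ (sumTo-cong n f≗g) (f≗g (suc n))

x≡y+0⇒x≡y : ∀ {x y z} → z ≡ 0ℚ → x ≡ y + z → x ≡ y
x≡y+0⇒x≡y {y = y} refl eq = trans eq (ℚP.+-identityʳ y)

*-inv-*-assoc : ∀ x {y z} → y ≢ 0ℚ → z ≢ 0ℚ → x * inv (y * z) ≡ x * inv y * inv z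
*-inv-*-assoc x {y} {z} y≢0 z≢0 = trans (cong (x *_) (inv-* y≢0 z≢0)) (sym (ℚP.*-assoc x (inv y) (inv z)))

factor-inv : ∀ {D} → D ≢ 0ℚ → ∀ L α A β B γ C →
  L - (α * inv D * A + β * inv D * B + γ * inv D * C) ≡ inv D * (D * L - (α * A + β * B + γ * C))
factor-inv {D} D≢0 L α A β B γ C = begin
  L - R                     ≡⟨ cong (_- R) (ℚP.*-identityˡ L) ⟨
  1ℚ * L - R                ≡⟨ cong (λ u → u * L - R) (*-inv D≢0) ⟨
  D * inv D * L - R         ≡⟨ solve 9 (λ D D⁻¹ L α A β B γ C →
                                 D :* D⁻¹ :* L :- (α :* D⁻¹ :* A :+ β :* D⁻¹ :* B :+ γ :* D⁻¹ :* C)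
                                   := D⁻¹ :* (D :* L :- (α :* A :+ β :* B :+ γ :* C)))
                               refl D (inv D) L α A β B γ C ⟩
  inv D * (D * L - (α * A + β * B + γ * C)) ∎
  where
  open ≡-Reasoning
  open ℚ-Solver
  R = α * inv D * A + β * inv D * B + γ * inv D * C

-- The recurrence of the summands

[2kCk]*[k!*k!]≡[2k]! : ∀ k → (2 ℕ.* k C k) ℕ.* (k ! ℕ.* k !) ≡ (2 ℕ.* k) !
[2kCk]*[k!*k!]≡[2k]! k = begin
  (2 ℕ.* k C k) ℕ.* (k ! ℕ.* k !)                ≡⟨ cong (λ i → (2 ℕ.* k C k) ℕ.* (k ! ℕ.* i !)) 2k∸k≡k ⟨
  (2 ℕ.* k C k) ℕ.* (k ! ℕ.* (2 ℕ.* k ∸ k) !)   ≡⟨ cong (ℕ._* (k ! ℕ.* (2 ℕ.* k ∸ k) !)) (nCk≡n!/k![n-k]! k≤2k) ⟩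
  _                                               ≡⟨ m/n*n≡m {{k !* (2 ℕ.* k ∸ k) !≢0}} (k![n∸k]!∣n! k≤2k) ⟩
  (2 ℕ.* k) !                                     ∎
  where
  open ≡-Reasoning
  open ℕP using (_!*_!≢0)
  k≤2k : k ≤ 2 ℕ.* k
  k≤2k = ℕP.m≤m+n k (k ℕ.+ 0)
  2k∸k≡k : 2 ℕ.* k ∸ k ≡ k
  2k∸k≡k = trans (ℕP.m+n∸m≡n k (k ℕ.+ 0)) (ℕP.+-identityʳ k)

[1+k]*[2[1+k]C[1+k]]≡2[1+2k]*[2kCk] : ∀ k → suc k ℕ.* (2 ℕ.* suc k C suc k) ≡ 2 ℕ.* (1 ℕ.+ 2 ℕ.* k) ℕ.* (2 ℕ.* k C k)
[1+k]*[2[1+k]C[1+k]]≡2[1+2k]*[2kCk] k =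
  ℕP.*-cancelʳ-≡ _ _ (k ! ℕ.* k !) {{k !* k !≢0}} (ℕP.*-cancelʳ-≡ _ _ (suc k) (begin
    suc k ℕ.* B′ ℕ.* (k ! ℕ.* k !) ℕ.* suc k
      ≡⟨ solve 4 (λ s b f g → s :* b :* (f :* g) :* s := b :* ((s :* f) :* (s :* g))) refl (suc k) B′ (k !) (k !) ⟩
    B′ ℕ.* (suc k ! ℕ.* suc k !)
      ≡⟨ [2kCk]*[k!*k!]≡[2k]! (suc k) ⟩
    (2 ℕ.* suc k) !
      ≡⟨ cong _! (solve 1 (λ k → con 2 :* (con 1 :+ k) := con 2 :+ con 2 :* k) refl k) ⟩
    suc (suc (2 ℕ.* k)) ℕ.* (suc (2 ℕ.* k) ℕ.* (2 ℕ.* k) !)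
      ≡⟨ cong (λ i → suc (suc (2 ℕ.* k)) ℕ.* (suc (2 ℕ.* k) ℕ.* i)) ([2kCk]*[k!*k!]≡[2k]! k) ⟨
    suc (suc (2 ℕ.* k)) ℕ.* (suc (2 ℕ.* k) ℕ.* (B ℕ.* (k ! ℕ.* k !)))
      ≡⟨ solve 3 (λ k b f → (con 2 :+ con 2 :* k) :* ((con 1 :+ con 2 :* k) :* (b :* f))
                          := con 2 :* (con 1 :+ con 2 :* k) :* b :* f :* (con 1 :+ k)) refl k B (k ! ℕ.* k !) ⟩
    2 ℕ.* (1 ℕ.+ 2 ℕ.* k) ℕ.* B ℕ.* (k ! ℕ.* k !) ℕ.* suc k ∎))
  where
  open ≡-Reasoning
  open ℕ-Solver
  open ℕP using (_!*_!≢0)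
  B = 2 ℕ.* k C k
  B′ = 2 ℕ.* suc k C suc k

binom-suc : ∀ x k → ℕ→ℚ (suc k) * binom x (suc k) ≡ binom x k * (x - ℕ→ℚ k)
binom-suc x k = begin
  ℕ→ℚ (suc k) * (binom x k * (x - ℕ→ℚ k) * (+ 1 ℚ./ suc k))
    ≡⟨ solve 3 (λ s b f → s :* (b :* f) := b :* (s :* f)) refl (ℕ→ℚ (suc k)) (binom x k * (x - ℕ→ℚ k)) (+ 1 ℚ./ suc k) ⟩
  binom x k * (x - ℕ→ℚ k) * (ℕ→ℚ (suc k) * (+ 1 ℚ./ suc k))
    ≡⟨ cong (binom x k * (x - ℕ→ℚ k) *_) (ℤ→ℚ-*-/ (+ 1) k) ⟩
  binom x k * (x - ℕ→ℚ k) * 1ℚ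
    ≡⟨ ℚP.*-identityʳ _ ⟩
  binom x k * (x - ℕ→ℚ k) ∎
  where open ≡-Reasoning
        open ℚ-Solver

central-binom-suc : ∀ k → ℕ→ℚ (suc k) * ℕ→ℚ (2 ℕ.* suc k C suc k)
                          ≡ ℕ→ℚ 2 * (1ℚ + ℕ→ℚ 2 * ℕ→ℚ k) * ℕ→ℚ (2 ℕ.* k C k)
central-binom-suc k = begin
  ℕ→ℚ (suc k) * ℕ→ℚ (2 ℕ.* suc k C suc k)            ≡⟨ ℕ→ℚ-* (suc k) (2 ℕ.* suc k C suc k) ⟨
  ℕ→ℚ (suc k ℕ.* (2 ℕ.* suc k C suc k))               ≡⟨ cong ℕ→ℚ ([1+k]*[2[1+k]C[1+k]]≡2[1+2k]*[2kCk] k) ⟩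
  ℕ→ℚ (2 ℕ.* (1 ℕ.+ 2 ℕ.* k) ℕ.* (2 ℕ.* k C k))      ≡⟨ ℕ→ℚ-* (2 ℕ.* (1 ℕ.+ 2 ℕ.* k)) (2 ℕ.* k C k) ⟩
  ℕ→ℚ (2 ℕ.* (1 ℕ.+ 2 ℕ.* k)) * ℕ→ℚ (2 ℕ.* k C k)   ≡⟨ cong (_* ℕ→ℚ (2 ℕ.* k C k)) 2[1+2k] ⟩
  ℕ→ℚ 2 * (1ℚ + ℕ→ℚ 2 * ℕ→ℚ k) * ℕ→ℚ (2 ℕ.* k C k) ∎
  where
  open ≡-Reasoning
  2[1+2k] : ℕ→ℚ (2 ℕ.* (1 ℕ.+ 2 ℕ.* k)) ≡ ℕ→ℚ 2 * (1ℚ + ℕ→ℚ 2 * ℕ→ℚ k)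
  2[1+2k] = trans (ℕ→ℚ-* 2 (1 ℕ.+ 2 ℕ.* k)) (cong (ℕ→ℚ 2 *_) (trans (ℕ→ℚ-suc (2 ℕ.* k)) (cong (λ x → 1ℚ + x) (ℕ→ℚ-* 2 k))))

c-suc : ∀ a k → ℕ→ℚ (suc k) * ℕ→ℚ (suc k) * ℕ→ℚ (suc k) * c a (suc k)
              ≡ ℕ→ℚ 2 * (1ℚ + ℕ→ℚ 2 * ℕ→ℚ k) * (a - ℕ→ℚ k) * (ℚ.- 1ℚ - a - ℕ→ℚ k) * c a k
c-suc a k = begin
  S * S * S * (binom a (suc k) * binom b (suc k) * ℕ→ℚ (2 ℕ.* suc k C suc k))
    ≡⟨ solve 4 (λ s x y z → s :* s :* s :* (x :* y :* z) := (s :* x) :* (s :* y) :* (s :* z))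
               refl S (binom a (suc k)) (binom b (suc k)) (ℕ→ℚ (2 ℕ.* suc k C suc k)) ⟩
  (S * binom a (suc k)) * (S * binom b (suc k)) * (S * ℕ→ℚ (2 ℕ.* suc k C suc k))
    ≡⟨ cong₂ _*_ (cong₂ _*_ (binom-suc a k) (binom-suc b k)) (central-binom-suc k) ⟩
  binom a k * (a - K) * (binom b k * (b - K)) * (ℕ→ℚ 2 * (1ℚ + ℕ→ℚ 2 * K) * ℕ→ℚ (2 ℕ.* k C k))
    ≡⟨ solve 7 (λ x y z a′ b′ K two → x :* (a′ :- K) :* (y :* (b′ :- K)) :* (two :* (con 1ℚ :+ two :* K) :* z)
                                    := two :* (con 1ℚ :+ two :* K) :* (a′ :- K) :* (b′ :- K) :* (x :* y :* z))
               refl (binom a k) (binom b k) (ℕ→ℚ (2 ℕ.* k C k)) a b K (ℕ→ℚ 2) ⟩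
  ℕ→ℚ 2 * (1ℚ + ℕ→ℚ 2 * K) * (a - K) * (b - K) * c a k ∎
  where
  open ≡-Reasoning
  open ℚ-Solver
  S = ℕ→ℚ (suc k)
  K = ℕ→ℚ k
  b = ℚ.- 1ℚ - a

term : ℚ → ℚ → ℕ → ℚ
term a m k = c a k * inv (m ^ℚ k)

^ℚ-≢0 : ∀ {m} → m ≢ 0ℚ → ∀ k → m ^ℚ k ≢ 0ℚ
^ℚ-≢0 m≢0 zero    = ℚP.1≢0
^ℚ-≢0 m≢0 (suc k) = *-≢0 m≢0 (^ℚ-≢0 m≢0 k)

term-suc : ∀ a {m} → m ≢ 0ℚ → ∀ k →
  m * (ℕ→ℚ (suc k) * ℕ→ℚ (suc k) * ℕ→ℚ (suc k)) * term a m (suc k)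
    ≡ ℕ→ℚ 2 * (1ℚ + ℕ→ℚ 2 * ℕ→ℚ k) * (a - ℕ→ℚ k) * (ℚ.- 1ℚ - a - ℕ→ℚ k) * term a m k
term-suc a {m} m≢0 k = begin
  m * S³ * (c a (suc k) * inv (m * m ^ℚ k))
    ≡⟨ cong (λ x → m * S³ * (c a (suc k) * x)) (inv-* m≢0 (^ℚ-≢0 m≢0 k)) ⟩
  m * S³ * (c a (suc k) * (inv m * inv (m ^ℚ k)))
    ≡⟨ solve 5 (λ m s c′ m⁻¹ x → m :* s :* (c′ :* (m⁻¹ :* x)) := (m :* m⁻¹) :* (s :* c′) :* x)
               refl m S³ (c a (suc k)) (inv m) (inv (m ^ℚ k)) ⟩
  (m * inv m) * (S³ * c a (suc k)) * inv (m ^ℚ k)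
    ≡⟨ cong₂ (λ x y → x * y * inv (m ^ℚ k)) (*-inv m≢0) (c-suc a k) ⟩
  1ℚ * (ratio * c a k) * inv (m ^ℚ k)
    ≡⟨ solve 3 (λ r c′ x → con 1ℚ :* (r :* c′) :* x := r :* (c′ :* x)) refl ratio (c a k) (inv (m ^ℚ k)) ⟩
  ratio * term a m k ∎
  where
  open ≡-Reasoning
  open ℚ-Solver
  S³ = ℕ→ℚ (suc k) * ℕ→ℚ (suc k) * ℕ→ℚ (suc k)
  ratio = ℕ→ℚ 2 * (1ℚ + ℕ→ℚ 2 * ℕ→ℚ k) * (a - ℕ→ℚ k) * (ℚ.- 1ℚ - a - ℕ→ℚ k)

-- The telescoping identity

module Telescoping (a m : ℚ) (t : ℕ → ℚ)
  (t-suc : ∀ k → m * (ℕ→ℚ (suc k) * ℕ→ℚ (suc k) * ℕ→ℚ (suc k)) * t (suc k)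
                   ≡ ℕ→ℚ 2 * (1ℚ + ℕ→ℚ 2 * ℕ→ℚ k) * (a - ℕ→ℚ k) * (ℚ.- 1ℚ - a - ℕ→ℚ k) * t k) where

  D E : ℚ
  D = ℕ→ℚ 6 * (a - 1ℚ) * (a + ℕ→ℚ 2)
  E = ℕ→ℚ 2 * a * (a + 1ℚ) - m

  t/[2+k] k*t t/[1+k] : ℕ → ℚ
  t/[2+k] k = t k * inv (ℕ→ℚ (2 ℕ.+ k))
  k*t     k = ℕ→ℚ k * t k
  t/[1+k] k = t k * inv (ℕ→ℚ (1 ℕ.+ k))

  defect : ℕ → ℚ
  defect n = D * sumTo n t/[2+k]
           - ((ℕ→ℚ 4 - m) * sumTo (2 ℕ.+ n) k*t + (m - ℕ→ℚ 6) * sumTo (2 ℕ.+ n) t + E * sumTo (1 ℕ.+ n) t/[1+k])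

  increment : ℕ → ℚ
  increment n = D * t/[2+k] (1 ℕ.+ n)
              - ((ℕ→ℚ 4 - m) * k*t (3 ℕ.+ n) + (m - ℕ→ℚ 6) * t (3 ℕ.+ n) + E * t/[1+k] (2 ℕ.+ n))

  boundaryForm : (N X Y v : ℚ) → ℚ
  boundaryForm N X Y v =
    Y * (ℚ.- (ℕ→ℚ 2 * (ℕ→ℚ 2 * N + 1ℚ)) + m * (ℕ→ℚ 3 * N * N + ℕ→ℚ 9 * N + ℕ→ℚ 7) * v) - ℕ→ℚ 6 * N * X

  boundary : ℕ → ℚ
  boundary n = boundaryForm (ℕ→ℚ n) (t (1 ℕ.+ n)) (t (2 ℕ.+ n)) (inv (ℕ→ℚ 2 * ℕ→ℚ n + ℕ→ℚ 3))

  defect-suc : ∀ n → defect (suc n) ≡ defect n + increment n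
  defect-suc n = solve 12 (λ D L l A₄ A α M₆ B β E C γ →
      D :* (L :+ l) :- (A₄ :* (A :+ α) :+ M₆ :* (B :+ β) :+ E :* (C :+ γ))
        := (D :* L :- (A₄ :* A :+ M₆ :* B :+ E :* C)) :+ (D :* l :- (A₄ :* α :+ M₆ :* β :+ E :* γ)))
    refl D (sumTo n t/[2+k]) (t/[2+k] (1 ℕ.+ n)) (ℕ→ℚ 4 - m) (sumTo (2 ℕ.+ n) k*t) (k*t (3 ℕ.+ n))
         (m - ℕ→ℚ 6) (sumTo (2 ℕ.+ n) t) (t (3 ℕ.+ n)) E (sumTo (1 ℕ.+ n) t/[1+k]) (t/[1+k] (2 ℕ.+ n))
    where open ℚ-Solver

  -- Jᵢ stands for ℕ→ℚ (i + j); linking the Jᵢ by equations lets boundary-suc apply this lemma without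
  -- rewriting. The two sides differ by a combination of the five remaining hypotheses (each read as
  -- lhs - rhs) with coefficients cw, cv, cv′, -3wv and v′w, which the ring solver verifies.
  boundary-step-identity : ∀ J J₁ J₂ J₃ X Y Z v v′ w →
    J₁ ≡ 1ℚ + J → J₂ ≡ 1ℚ + J₁ → J₃ ≡ 1ℚ + J₂ →
    m * (J₂ * J₂ * J₂) * Y ≡ ℕ→ℚ 2 * (1ℚ + ℕ→ℚ 2 * J₁) * (a - J₁) * (ℚ.- 1ℚ - a - J₁) * X →
    m * (J₃ * J₃ * J₃) * Z ≡ ℕ→ℚ 2 * (1ℚ + ℕ→ℚ 2 * J₂) * (a - J₂) * (ℚ.- 1ℚ - a - J₂) * Y →
    (ℕ→ℚ 2 * J + ℕ→ℚ 3) * v ≡ 1ℚ → (ℕ→ℚ 2 * J₁ + ℕ→ℚ 3) * v′ ≡ 1ℚ → J₃ * w ≡ 1ℚ →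
    boundaryForm J₁ Y Z v′
      ≡ boundaryForm J X Y v + (D * (X * w) - ((ℕ→ℚ 4 - m) * (J₃ * Z) + (m - ℕ→ℚ 6) * Z + E * (Y * w)))
  boundary-step-identity J _ _ _ X Y Z v v′ w refl refl refl ρ₁ ρ₂ ε ε′ εw =
    x≡y+0⇒x≡y
      (cong₂ _+_ (cong₂ _+_ (cong₂ _+_ (cong₂ _+_
        (*-diff≡0 cw εw) (*-diff≡0 cv ε)) (*-diff≡0 cv′ ε′)) (*-diff≡0 (ℚ.- (ℕ→ℚ 3 * w * v)) ρ₁)) (*-diff≡0 (v′ * w) ρ₂))
      (solve 9 (λ a m J X Y Z v v′ w →
        let J₁ = con 1ℚ :+ J ; J₂ = con 1ℚ :+ J₁ ; J₃ = con 1ℚ :+ J₂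
            form = λ N X Y v → Y :* (:- (# 2 :* (# 2 :* N :+ con 1ℚ)) :+ m :* (# 3 :* N :* N :+ # 9 :* N :+ # 7) :* v) :- # 6 :* N :* X
        in form J₁ Y Z v′
           := form J X Y v
              :+ (# 6 :* (a :- con 1ℚ) :* (a :+ # 2) :* (X :* w)
                  :- ((# 4 :- m) :* (J₃ :* Z) :+ (m :- # 6) :* Z :+ (# 2 :* a :* (a :+ con 1ℚ) :- m) :* (Y :* w)))
              :+ ((:- (# 6 :* J :* X) :- m :* ((J :+ # 3) :* (J :+ # 3)) :* v′ :* Z :+ # 2 :* (J :+ # 2) :* Y
                     :+ m :* (# 3 :* J :* J :+ # 9 :* J :+ # 7) :* v :* Y) :* (J₃ :* w :- con 1ℚ)
                  :+ (:- (# 6 :* ((J :+ con 1ℚ :- a) :* (J :+ # 2 :+ a)) :* X :* w) :+ m :* w :* Y)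
                       :* ((# 2 :* J :+ # 3) :* v :- con 1ℚ)
                  :+ (# 2 :* w :* ((J :+ # 2 :- a) :* (J :+ # 3 :+ a)) :* Y :+ m :* (J :+ # 2) :* Z)
                       :* ((# 2 :* J₁ :+ # 3) :* v′ :- con 1ℚ)
                  :+ (:- (# 3 :* w :* v))
                       :* (m :* (J₂ :* J₂ :* J₂) :* Y :- # 2 :* (con 1ℚ :+ # 2 :* J₁) :* (a :- J₁) :* (:- con 1ℚ :- a :- J₁) :* X)
                  :+ v′ :* w
                       :* (m :* (J₃ :* J₃ :* J₃) :* Z :- # 2 :* (con 1ℚ :+ # 2 :* J₂) :* (a :- J₂) :* (:- con 1ℚ :- a :- J₂) :* Y)))
        refl a m J X Y Z v v′ w)
    where
    open ℚ-Solver
    cw = ℚ.- (ℕ→ℚ 6 * J * X) - m * ((J + ℕ→ℚ 3) * (J + ℕ→ℚ 3)) * v′ * Z + ℕ→ℚ 2 * (J + ℕ→ℚ 2) * Y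
         + m * (ℕ→ℚ 3 * J * J + ℕ→ℚ 9 * J + ℕ→ℚ 7) * v * Y
    cv = ℚ.- (ℕ→ℚ 6 * ((J + 1ℚ - a) * (J + ℕ→ℚ 2 + a)) * X * w) + m * w * Y
    cv′ = ℕ→ℚ 2 * w * ((J + ℕ→ℚ 2 - a) * (J + ℕ→ℚ 3 + a)) * Y + m * (J + ℕ→ℚ 2) * Z

  boundary-suc : ∀ n → boundary (suc n) ≡ boundary n + increment n
  boundary-suc n = boundary-step-identity (ℕ→ℚ n) _ _ _ (t (1 ℕ.+ n)) (t (2 ℕ.+ n)) (t (3 ℕ.+ n))
    (inv (ℕ→ℚ 2 * ℕ→ℚ n + ℕ→ℚ 3)) (inv (ℕ→ℚ 2 * ℕ→ℚ (1 ℕ.+ n) + ℕ→ℚ 3)) (inv (ℕ→ℚ (3 ℕ.+ n)))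
    (ℕ→ℚ-suc n) (ℕ→ℚ-suc (1 ℕ.+ n)) (ℕ→ℚ-suc (2 ℕ.+ n))
    (t-suc (1 ℕ.+ n)) (t-suc (2 ℕ.+ n))
    (*-inv (2n+3≢0 n)) (*-inv (2n+3≢0 (1 ℕ.+ n))) (*-inv (ℕ→ℚ-suc≢0 (2 ℕ.+ n)))

  defect≡boundary : ∀ n → defect n ≡ boundary n
  defect≡boundary zero = x≡y+0⇒x≡y
    (cong₂ _+_ (*-diff≡0 (+ 1 ℚ./ 2) (t-suc 0)) (*-diff≡0 (ℚ.- (+ 1 ℚ./ 6)) (t-suc 1)))
    (solve 5 (λ a m t₀ t₁ t₂ →
        # 6 :* (a :- con 1ℚ) :* (a :+ # 2) :* (t₀ :* con (inv (ℕ→ℚ 2)))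
          :- ((# 4 :- m) :* (# 0 :* t₀ :+ # 1 :* t₁ :+ # 2 :* t₂) :+ (m :- # 6) :* (t₀ :+ t₁ :+ t₂)
              :+ (# 2 :* a :* (a :+ con 1ℚ) :- m) :* (t₀ :* con (inv (ℕ→ℚ 1)) :+ t₁ :* con (inv (ℕ→ℚ 2))))
        := t₂ :* (:- (# 2 :* (# 2 :* # 0 :+ con 1ℚ)) :+ m :* (# 3 :* # 0 :* # 0 :+ # 9 :* # 0 :+ # 7)
                    :* con (inv (ℕ→ℚ 2 * ℕ→ℚ 0 + ℕ→ℚ 3))) :- # 6 :* # 0 :* t₁
           :+ (con (+ 1 ℚ./ 2) :* (m :* (# 1 :* # 1 :* # 1) :* t₁
                                    :- # 2 :* (con 1ℚ :+ # 2 :* # 0) :* (a :- # 0) :* (:- con 1ℚ :- a :- # 0) :* t₀)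
               :+ con (ℚ.- (+ 1 ℚ./ 6)) :* (m :* (# 2 :* # 2 :* # 2) :* t₂
                                    :- # 2 :* (con 1ℚ :+ # 2 :* # 1) :* (a :- # 1) :* (:- con 1ℚ :- a :- # 1) :* t₁)))
      refl a m (t 0) (t 1) (t 2))
    where open ℚ-Solver
  defect≡boundary (suc n) = begin
    defect (suc n)                 ≡⟨ defect-suc n ⟩
    defect n + increment n         ≡⟨ cong (_+ increment n) (defect≡boundary n) ⟩
    boundary n + increment n       ≡⟨ boundary-suc n ⟨
    boundary (suc n)               ∎
    where open ≡-Reasoning

-- p-integral rationals

module PAdic {p : ℕ} (p-prime : Prime p) where

  private instance
    p-nonTrivial : ℕ.NonTrivial p
    p-nonTrivial = prime⇒nonTrivial p-prime
    p-nonZero : ℕ.NonZero p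
    p-nonZero = ℕ.nonTrivial⇒nonZero p

  p∤1 : p ∤ 1
  p∤1 p∣1 = ℕ.nonTrivial⇒≢1 (∣1⇒≡1 p∣1)

  p∤∣*∣ : ∀ {x y} → p ∤ ℤ.∣ x ∣ → p ∤ ℤ.∣ y ∣ → p ∤ ℤ.∣ x ℤ.* y ∣
  p∤∣*∣ {x} {y} p∤x p∤y p∣xy =
    [ p∤x , p∤y ]′ (euclidsLemma ℤ.∣ x ∣ ℤ.∣ y ∣ p-prime (subst (p ∣_) (ℤP.abs-* x y) p∣xy))

  p∤⇒ℤ→ℚ≢0 : ∀ {d} → p ∤ ℤ.∣ d ∣ → ℤ→ℚ d ≢ 0ℚ
  p∤⇒ℤ→ℚ≢0 {d} p∤d d≡0 = p∤d (subst (λ z → p ∣ ℤ.∣ z ∣) (sym (ℤ→ℚ-injective {d} {+ 0} d≡0)) (p ∣0))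

  -- A representation q = num/den with p ∤ den, not necessarily reduced (unlike InZp).
  record Integral (q : ℚ) : Set where
    constructor integral
    field
      den num   : ℤ
      p∤den     : p ∤ ℤ.∣ den ∣
      den*q≡num : ℤ→ℚ den * q ≡ ℤ→ℚ num

  record Divisible (e : ℕ) (q : ℚ) : Set where
    constructor divisible
    field
      quotient          : ℚ
      integral-quotient : Integral quotient
      ≡pᵉ*quotient      : q ≡ ℕ→ℚ (p ^ e) * quotient

  integral-ℤ : ∀ z → Integral (ℤ→ℚ z)
  integral-ℤ z = integral (+ 1) z p∤1 (ℚP.*-identityˡ (ℤ→ℚ z))

  integral-ℕ : ∀ k → Integral (ℕ→ℚ k)
  integral-ℕ k = integral-ℤ (+ k)

  integral-* : ∀ {x y} → Integral x → Integral y → Integral (x * y)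
  integral-* {x} {y} (integral d₁ n₁ p∤d₁ eq₁) (integral d₂ n₂ p∤d₂ eq₂) =
    integral (d₁ ℤ.* d₂) (n₁ ℤ.* n₂) (p∤∣*∣ {d₁} {d₂} p∤d₁ p∤d₂) (begin
      ℤ→ℚ (d₁ ℤ.* d₂) * (x * y)              ≡⟨ cong (_* (x * y)) (ℤ→ℚ-* d₁ d₂) ⟩
      ℤ→ℚ d₁ * ℤ→ℚ d₂ * (x * y)              ≡⟨ solve 4 (λ a b x y → a :* b :* (x :* y) := (a :* x) :* (b :* y)) refl (ℤ→ℚ d₁) (ℤ→ℚ d₂) x y ⟩
      (ℤ→ℚ d₁ * x) * (ℤ→ℚ d₂ * y)            ≡⟨ cong₂ _*_ eq₁ eq₂ ⟩
      ℤ→ℚ n₁ * ℤ→ℚ n₂                        ≡⟨ ℤ→ℚ-* n₁ n₂ ⟨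
      ℤ→ℚ (n₁ ℤ.* n₂)                        ∎)
    where open ≡-Reasoning
          open ℚ-Solver

  integral-+ : ∀ {x y} → Integral x → Integral y → Integral (x + y)
  integral-+ {x} {y} (integral d₁ n₁ p∤d₁ eq₁) (integral d₂ n₂ p∤d₂ eq₂) =
    integral (d₁ ℤ.* d₂) (n₁ ℤ.* d₂ ℤ.+ n₂ ℤ.* d₁) (p∤∣*∣ {d₁} {d₂} p∤d₁ p∤d₂) (begin
      ℤ→ℚ (d₁ ℤ.* d₂) * (x + y)                       ≡⟨ cong (_* (x + y)) (ℤ→ℚ-* d₁ d₂) ⟩
      ℤ→ℚ d₁ * ℤ→ℚ d₂ * (x + y)                       ≡⟨ solve 4 (λ a b x y → a :* b :* (x :+ y) := (a :* x) :* b :+ (b :* y) :* a) refl (ℤ→ℚ d₁) (ℤ→ℚ d₂) x y ⟩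
      (ℤ→ℚ d₁ * x) * ℤ→ℚ d₂ + (ℤ→ℚ d₂ * y) * ℤ→ℚ d₁  ≡⟨ cong₂ (λ u v → u * ℤ→ℚ d₂ + v * ℤ→ℚ d₁) eq₁ eq₂ ⟩
      ℤ→ℚ n₁ * ℤ→ℚ d₂ + ℤ→ℚ n₂ * ℤ→ℚ d₁               ≡⟨ cong₂ _+_ (ℤ→ℚ-* n₁ d₂) (ℤ→ℚ-* n₂ d₁) ⟨
      ℤ→ℚ (n₁ ℤ.* d₂) + ℤ→ℚ (n₂ ℤ.* d₁)               ≡⟨ ℤ→ℚ-+ (n₁ ℤ.* d₂) (n₂ ℤ.* d₁) ⟨
      ℤ→ℚ (n₁ ℤ.* d₂ ℤ.+ n₂ ℤ.* d₁)                   ∎)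
    where open ≡-Reasoning
          open ℚ-Solver

  integral-neg : ∀ {x} → Integral x → Integral (ℚ.- x)
  integral-neg {x} (integral d n p∤d eq) = integral d (ℤ.- n) p∤d (begin
    ℤ→ℚ d * ℚ.- x       ≡⟨ ℚP.neg-distribʳ-* (ℤ→ℚ d) x ⟨
    ℚ.- (ℤ→ℚ d * x)     ≡⟨ cong ℚ.-_ eq ⟩
    ℚ.- ℤ→ℚ n           ≡⟨ ℤ→ℚ-neg n ⟨
    ℤ→ℚ (ℤ.- n)         ∎)
    where open ≡-Reasoning

  integral-- : ∀ {x y} → Integral x → Integral y → Integral (x - y)
  integral-- ix iy = integral-+ ix (integral-neg iy)

  divisible-fraction : ∀ {e y d r} → p ∤ ℤ.∣ d ∣ → ℤ→ℚ d * y ≡ ℕ→ℚ (p ^ e) * ℤ→ℚ r → Divisible e y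
  divisible-fraction {e} {y} {d} {r} p∤d eq = divisible (ℤ→ℚ r * inv (ℤ→ℚ d)) (integral d r p∤d den*w≡r) y≡pᵉw
    where
    open ≡-Reasoning
    open ℚ-Solver
    d*d⁻¹≡1 = *-inv (p∤⇒ℤ→ℚ≢0 {d} p∤d)
    den*w≡r : ℤ→ℚ d * (ℤ→ℚ r * inv (ℤ→ℚ d)) ≡ ℤ→ℚ r
    den*w≡r = begin
      ℤ→ℚ d * (ℤ→ℚ r * inv (ℤ→ℚ d))   ≡⟨ solve 3 (λ d r d⁻¹ → d :* (r :* d⁻¹) := r :* (d :* d⁻¹)) refl (ℤ→ℚ d) (ℤ→ℚ r) (inv (ℤ→ℚ d)) ⟩
      ℤ→ℚ r * (ℤ→ℚ d * inv (ℤ→ℚ d))   ≡⟨ cong (ℤ→ℚ r *_) d*d⁻¹≡1 ⟩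
      ℤ→ℚ r * 1ℚ                       ≡⟨ ℚP.*-identityʳ (ℤ→ℚ r) ⟩
      ℤ→ℚ r                            ∎
    y≡pᵉw : y ≡ ℕ→ℚ (p ^ e) * (ℤ→ℚ r * inv (ℤ→ℚ d))
    y≡pᵉw = begin
      y                                   ≡⟨ ℚP.*-identityˡ y ⟨
      1ℚ * y                              ≡⟨ cong (_* y) (trans (ℚP.*-comm (inv (ℤ→ℚ d)) (ℤ→ℚ d)) d*d⁻¹≡1) ⟨
      inv (ℤ→ℚ d) * ℤ→ℚ d * y             ≡⟨ ℚP.*-assoc (inv (ℤ→ℚ d)) (ℤ→ℚ d) y ⟩
      inv (ℤ→ℚ d) * (ℤ→ℚ d * y)           ≡⟨ cong (inv (ℤ→ℚ d) *_) eq ⟩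
      inv (ℤ→ℚ d) * (ℕ→ℚ (p ^ e) * ℤ→ℚ r) ≡⟨ solve 3 (λ d⁻¹ P r → d⁻¹ :* (P :* r) := P :* (r :* d⁻¹)) refl (inv (ℤ→ℚ d)) (ℕ→ℚ (p ^ e)) (ℤ→ℚ r) ⟩
      ℕ→ℚ (p ^ e) * (ℤ→ℚ r * inv (ℤ→ℚ d)) ∎

  divisible-* : ∀ {e f x y} → Divisible e x → Divisible f y → Divisible (e ℕ.+ f) (x * y)
  divisible-* {e} {f} (divisible w₁ iw₁ refl) (divisible w₂ iw₂ refl) = divisible (w₁ * w₂) (integral-* iw₁ iw₂) (begin
    ℕ→ℚ (p ^ e) * w₁ * (ℕ→ℚ (p ^ f) * w₂)   ≡⟨ solve 4 (λ P Q x y → P :* x :* (Q :* y) := P :* Q :* (x :* y)) refl (ℕ→ℚ (p ^ e)) (ℕ→ℚ (p ^ f)) w₁ w₂ ⟩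
    ℕ→ℚ (p ^ e) * ℕ→ℚ (p ^ f) * (w₁ * w₂)   ≡⟨ cong (_* (w₁ * w₂)) (ℕ→ℚ-* (p ^ e) (p ^ f)) ⟨
    ℕ→ℚ (p ^ e ℕ.* p ^ f) * (w₁ * w₂)       ≡⟨ cong (λ n → ℕ→ℚ n * (w₁ * w₂)) (ℕP.^-distribˡ-+-* p e f) ⟨
    ℕ→ℚ (p ^ (e ℕ.+ f)) * (w₁ * w₂)          ∎)
    where open ≡-Reasoning
          open ℚ-Solver

  divisible-*-integral : ∀ {e x y} → Divisible e x → Integral y → Divisible e (x * y)
  divisible-*-integral {e} {y = y} (divisible w iw refl) iy = divisible (w * y) (integral-* iw iy) (ℚP.*-assoc (ℕ→ℚ (p ^ e)) w y)

  integral-*-divisible : ∀ {e x y} → Integral x → Divisible e y → Divisible e (x * y)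
  integral-*-divisible {e} {x} {y} ix dy = subst (Divisible e) (ℚP.*-comm y x) (divisible-*-integral {e} dy ix)

  divisible-+ : ∀ {e x y} → Divisible e x → Divisible e y → Divisible e (x + y)
  divisible-+ {e} (divisible w₁ iw₁ refl) (divisible w₂ iw₂ refl) =
    divisible (w₁ + w₂) (integral-+ iw₁ iw₂) (sym (ℚP.*-distribˡ-+ (ℕ→ℚ (p ^ e)) w₁ w₂))

  divisible-neg : ∀ {e x} → Divisible e x → Divisible e (ℚ.- x)
  divisible-neg {e} (divisible w iw refl) = divisible (ℚ.- w) (integral-neg iw) (ℚP.neg-distribʳ-* (ℕ→ℚ (p ^ e)) w)

  divisible-- : ∀ {e x y} → Divisible e x → Divisible e y → Divisible e (x - y)
  divisible-- {e} dx dy = divisible-+ {e} dx (divisible-neg {e} dy)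

  divisible-ℕ : ∀ {n} → p ∣ n → Divisible 1 (ℕ→ℚ n)
  divisible-ℕ {n} (divides q refl) = divisible (ℕ→ℚ q) (integral-ℤ (+ q)) (begin
    ℕ→ℚ (q ℕ.* p)              ≡⟨ ℕ→ℚ-* q p ⟩
    ℕ→ℚ q * ℕ→ℚ p              ≡⟨ ℚP.*-comm (ℕ→ℚ q) (ℕ→ℚ p) ⟩
    ℕ→ℚ p * ℕ→ℚ q              ≡⟨ cong (λ n → ℕ→ℚ n * ℕ→ℚ q) (ℕP.*-identityʳ p) ⟨
    ℕ→ℚ (p ^ 1) * ℕ→ℚ q        ∎)
    where open ≡-Reasoning

  ¬divisible⇒≢0 : ∀ {e x} → ¬ Divisible e x → x ≢ 0ℚ
  ¬divisible⇒≢0 {e} ¬dx refl = ¬dx (divisible 0ℚ (integral-ℤ (+ 0)) (sym (ℚP.*-zeroʳ (ℕ→ℚ (p ^ e)))))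

  ¬divisible-ℤ : ∀ {n} → p ∤ ℤ.∣ n ∣ → ¬ Divisible 1 (ℤ→ℚ n)
  ¬divisible-ℤ {n} p∤n (divisible w (integral d r p∤d eq) n≡pw) =
    [ p∤d , p∤n ]′ (euclidsLemma ℤ.∣ d ∣ ℤ.∣ n ∣ p-prime (divides ℤ.∣ r ∣ (begin
      ℤ.∣ d ∣ ℕ.* ℤ.∣ n ∣          ≡⟨ ℤP.abs-* d n ⟨
      ℤ.∣ d ℤ.* n ∣                ≡⟨ cong ℤ.∣_∣ (ℤ→ℚ-injective {d ℤ.* n} {+ p ℤ.* r} d*n≡p*r) ⟩
      ℤ.∣ + p ℤ.* r ∣              ≡⟨ ℤP.abs-* (+ p) r ⟩
      p ℕ.* ℤ.∣ r ∣                ≡⟨ ℕP.*-comm p ℤ.∣ r ∣ ⟩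
      ℤ.∣ r ∣ ℕ.* p                ∎)))
    where
    d*n≡p*r : ℤ→ℚ (d ℤ.* n) ≡ ℤ→ℚ (+ p ℤ.* r)
    d*n≡p*r = begin
      ℤ→ℚ (d ℤ.* n)            ≡⟨ ℤ→ℚ-* d n ⟩
      ℤ→ℚ d * ℤ→ℚ n            ≡⟨ cong (ℤ→ℚ d *_) n≡pw ⟩
      ℤ→ℚ d * (ℕ→ℚ (p ^ 1) * w) ≡⟨ solve 3 (λ d P w → d :* (P :* w) := P :* (d :* w)) refl (ℤ→ℚ d) (ℕ→ℚ (p ^ 1)) w ⟩
      ℕ→ℚ (p ^ 1) * (ℤ→ℚ d * w) ≡⟨ cong₂ (λ n x → ℕ→ℚ n * x) (ℕP.*-identityʳ p) eq ⟩
      ℕ→ℚ p * ℤ→ℚ r            ≡⟨ ℤ→ℚ-* (+ p) r ⟨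
      ℤ→ℚ (+ p ℤ.* r)          ∎
      where open ≡-Reasoning
            open ℚ-Solver
    open ≡-Reasoning

  integral-inv : ∀ {x} → Integral x → ¬ Divisible 1 x → Integral (inv x)
  integral-inv {x} (integral d n p∤d eq) ¬dx with p ∣? ℤ.∣ n ∣
  ... | yes p∣n = ⊥-elim (¬dx (divisible-fraction {1} {x} {d} {q} p∤d (begin
          ℤ→ℚ d * x             ≡⟨ eq ⟩
          ℤ→ℚ n                 ≡⟨ cong ℤ→ℚ (ℤDiv._∣_.equality p∣ₛn) ⟩
          ℤ→ℚ (q ℤ.* + p)       ≡⟨ ℤ→ℚ-* q (+ p) ⟩
          ℤ→ℚ q * ℕ→ℚ p         ≡⟨ ℚP.*-comm (ℤ→ℚ q) (ℕ→ℚ p) ⟩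
          ℕ→ℚ p * ℤ→ℚ q         ≡⟨ cong (λ n → ℕ→ℚ n * ℤ→ℚ q) (ℕP.*-identityʳ p) ⟨
          ℕ→ℚ (p ^ 1) * ℤ→ℚ q   ∎)))
    where
    open ≡-Reasoning
    p∣ₛn = ℤDiv.∣ᵤ⇒∣ {+ p} {n} p∣n
    q = ℤDiv._∣_.quotient p∣ₛn
  ... | no p∤n = integral n d p∤n (begin
          ℤ→ℚ n * inv x           ≡⟨ cong (_* inv x) eq ⟨
          ℤ→ℚ d * x * inv x       ≡⟨ ℚP.*-assoc (ℤ→ℚ d) x (inv x) ⟩
          ℤ→ℚ d * (x * inv x)     ≡⟨ cong (ℤ→ℚ d *_) (*-inv (¬divisible⇒≢0 {1} ¬dx)) ⟩
          ℤ→ℚ d * 1ℚ              ≡⟨ ℚP.*-identityʳ (ℤ→ℚ d) ⟩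
          ℤ→ℚ d                   ∎)
    where open ≡-Reasoning

  integral-inv-* : ∀ {x y} → x ≢ 0ℚ → y ≢ 0ℚ → Integral (inv x) → Integral (inv y) → Integral (inv (x * y))
  integral-inv-* x≢0 y≢0 ix⁻¹ iy⁻¹ = subst Integral (sym (inv-* x≢0 y≢0)) (integral-* ix⁻¹ iy⁻¹)

  integral-inv-^ : ∀ {m} → m ≢ 0ℚ → Integral (inv m) → ∀ k → Integral (inv (m ^ℚ k))
  integral-inv-^ m≢0 im⁻¹ zero    = integral-ℤ (+ 1)
  integral-inv-^ m≢0 im⁻¹ (suc k) = integral-inv-* m≢0 (^ℚ-≢0 m≢0 k) im⁻¹ (integral-inv-^ m≢0 im⁻¹ k)

  InZp⇒integral : ∀ {q} → InZp p q → Integral q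
  InZp⇒integral {q@(mkℚ _ _ _)} p∤↧q = integral (↧ q) (↥ q) p∤↧q (↧*≡↥ q)

  integral⇒InZp : ∀ {q} → Integral q → InZp p q
  integral⇒InZp {q@(mkℚ n′ d′ coprime)} (integral d n p∤d eq) p∣↧q = p∤d (∣-trans p∣↧q ↧q∣d)
    where
    d*n′≡↧q*n : d ℤ.* n′ ≡ + suc d′ ℤ.* n
    d*n′≡↧q*n = ℤ→ℚ-injective (begin
      ℤ→ℚ (d ℤ.* n′)                   ≡⟨ ℤ→ℚ-* d n′ ⟩
      ℤ→ℚ d * ℤ→ℚ n′                   ≡⟨ cong (ℤ→ℚ d *_) (↧*≡↥ q) ⟨
      ℤ→ℚ d * (ℤ→ℚ (+ suc d′) * q)     ≡⟨ solve 3 (λ a b q → a :* (b :* q) := b :* (a :* q)) refl (ℤ→ℚ d) (ℤ→ℚ (+ suc d′)) q ⟩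
      ℤ→ℚ (+ suc d′) * (ℤ→ℚ d * q)     ≡⟨ cong (ℤ→ℚ (+ suc d′) *_) eq ⟩
      ℤ→ℚ (+ suc d′) * ℤ→ℚ n           ≡⟨ ℤ→ℚ-* (+ suc d′) n ⟨
      ℤ→ℚ (+ suc d′ ℤ.* n)             ∎)
      where open ≡-Reasoning
            open ℚ-Solver
    ↧q∣d : suc d′ ∣ ℤ.∣ d ∣
    ↧q∣d = Coprime.coprime-divisor (Coprime.sym (Coprime.recompute coprime)) (divides ℤ.∣ n ∣ (begin
      ℤ.∣ n′ ∣ ℕ.* ℤ.∣ d ∣     ≡⟨ ℕP.*-comm ℤ.∣ n′ ∣ ℤ.∣ d ∣ ⟩
      ℤ.∣ d ∣ ℕ.* ℤ.∣ n′ ∣     ≡⟨ ℤP.abs-* d n′ ⟨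
      ℤ.∣ d ℤ.* n′ ∣           ≡⟨ cong ℤ.∣_∣ d*n′≡↧q*n ⟩
      ℤ.∣ + suc d′ ℤ.* n ∣     ≡⟨ ℤP.abs-* (+ suc d′) n ⟩
      suc d′ ℕ.* ℤ.∣ n ∣       ≡⟨ ℕP.*-comm (suc d′) ℤ.∣ n ∣ ⟩
      ℤ.∣ n ∣ ℕ.* suc d′       ∎))
      where open ≡-Reasoning

  divisible⇒CongMod : ∀ {e x y} → Divisible e (x - y) → CongMod p e x y
  divisible⇒CongMod (divisible w iw eq) = w , integral⇒InZp iw , eq

  ¬CongMod⇒¬divisible : ∀ {e x y} → ¬ CongMod p e x y → ¬ Divisible e (x - y)
  ¬CongMod⇒¬divisible {e} {x} {y} x≢y d = x≢y (divisible⇒CongMod {e} {x} {y} d)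

  inverse-mod-pₙ : ∀ k → p ∤ k → ∃ λ u → ∃ λ v → u ℤ.* + k ≡ + 1 ℤ.+ v ℤ.* + p
  inverse-mod-pₙ k p∤k with Coprime.coprime-Bézout coprime
    where
    coprime : Coprime.Coprime p k
    coprime (i∣p , i∣k) with prime⇒irreducible p-prime i∣p
    ... | inj₁ i≡1  = i≡1
    ... | inj₂ refl = ⊥-elim (p∤k i∣k)
  ... | ℕGCD.Bézout.+- x y eq = ℤ.- (+ y) , ℤ.- (+ x) , (begin
    ℤ.- (+ y) ℤ.* + k                  ≡⟨ solve 2 (λ y k → (:- y) :* k := con (+ 1) :- (con (+ 1) :+ y :* k)) refl (+ y) (+ k) ⟩
    + 1 ℤ.- (+ 1 ℤ.+ + y ℤ.* + k)      ≡⟨ cong (λ z → + 1 ℤ.- z) (embed {y} {k} {x} eq) ⟩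
    + 1 ℤ.- + x ℤ.* + p                ≡⟨ solve 2 (λ x p → con (+ 1) :- x :* p := con (+ 1) :+ (:- x) :* p) refl (+ x) (+ p) ⟩
    + 1 ℤ.+ ℤ.- (+ x) ℤ.* + p          ∎)
    where open ≡-Reasoning
          open ℤ-Solver
          embed : ∀ {a b c} → 1 ℕ.+ a ℕ.* b ≡ c ℕ.* p → + 1 ℤ.+ + a ℤ.* + b ≡ + c ℤ.* + p
          embed {a} {b} {c} eq = trans (cong (λ z → + 1 ℤ.+ z) (sym (ℤP.pos-* a b)))
                                   (trans (cong +_ eq) (ℤP.pos-* c p))
  ... | ℕGCD.Bézout.-+ x y eq = + y , + x , sym (begin
    + 1 ℤ.+ + x ℤ.* + p    ≡⟨ cong (λ z → + 1 ℤ.+ z) (ℤP.pos-* x p) ⟨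
    + (1 ℕ.+ x ℕ.* p)      ≡⟨ cong +_ eq ⟩
    + (y ℕ.* k)            ≡⟨ ℤP.pos-* y k ⟩
    + y ℤ.* + k            ∎)
    where open ≡-Reasoning

  inverse-mod-p : ∀ d → p ∤ ℤ.∣ d ∣ → ∃ λ u → ∃ λ v → u ℤ.* d ≡ + 1 ℤ.+ v ℤ.* + p
  inverse-mod-p (+ k)      p∤d = inverse-mod-pₙ k p∤d
  inverse-mod-p -[1+ k ] p∤d with inverse-mod-pₙ (suc k) p∤d
  ... | u , v , eq = ℤ.- u , v , trans (solve 2 (λ u k → (:- u) :* (:- k) := u :* k) refl u (+ suc k)) eq
    where open ℤ-Solver

  residue-identity : ∀ {d n u v j q} → u ℤ.* d ≡ + 1 ℤ.+ v ℤ.* + p → n ℤ.* u ≡ j ℤ.+ q ℤ.* + p →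
                     n ℤ.- d ℤ.* j ≡ + p ℤ.* (q ℤ.* d ℤ.- n ℤ.* v)
  residue-identity {d} {n} {u} {v} {j} {q} ud≡1+vp nu≡j+qp = begin
    n ℤ.- d ℤ.* j
      ≡⟨ solve 6 (λ d j n q p v → n :- d :* j := n :* (con (+ 1) :+ v :* p) :- d :* (j :+ q :* p) :+ p :* (q :* d :- n :* v))
                 refl d j n q (+ p) v ⟩
    n ℤ.* (+ 1 ℤ.+ v ℤ.* + p) ℤ.- d ℤ.* (j ℤ.+ q ℤ.* + p) ℤ.+ + p ℤ.* r
      ≡⟨ cong₂ (λ x y → n ℤ.* x ℤ.- d ℤ.* y ℤ.+ + p ℤ.* r) ud≡1+vp nu≡j+qp ⟨
    n ℤ.* (u ℤ.* d) ℤ.- d ℤ.* (n ℤ.* u) ℤ.+ + p ℤ.* r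
      ≡⟨ solve 5 (λ d n u p r → n :* (u :* d) :- d :* (n :* u) :+ p :* r := p :* r) refl d n u (+ p) r ⟩
    + p ℤ.* r ∎
    where open ≡-Reasoning
          open ℤ-Solver
          r = q ℤ.* d ℤ.- n ℤ.* v

  residue : ∀ {x} → Integral x → ∃ λ j → j < p × Divisible 1 (x - ℕ→ℚ j)
  residue {x} (integral d n p∤d eq) with inverse-mod-p d p∤d
  ... | u , v , ud≡1+vp = j , ℤDivMod.n%ℕd<d (n ℤ.* u) p , divisible-fraction {1} {x - ℕ→ℚ j} {d} {r} p∤d (begin
      ℤ→ℚ d * (x - ℕ→ℚ j)           ≡⟨ solve 3 (λ d j x → d :* (x :- j) := d :* x :- d :* j) refl (ℤ→ℚ d) (ℕ→ℚ j) x ⟩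
      ℤ→ℚ d * x - ℤ→ℚ d * ℕ→ℚ j     ≡⟨ cong₂ _-_ eq (sym (ℤ→ℚ-* d (+ j))) ⟩
      ℤ→ℚ n - ℤ→ℚ (d ℤ.* + j)       ≡⟨ ℤ→ℚ-- n (d ℤ.* + j) ⟨
      ℤ→ℚ (n ℤ.- d ℤ.* + j)         ≡⟨ cong ℤ→ℚ (residue-identity {d} {n} {u} {v} {+ j} {q} ud≡1+vp (ℤDivMod.a≡a%ℕn+[a/ℕn]*n (n ℤ.* u) p)) ⟩
      ℤ→ℚ (+ p ℤ.* r)               ≡⟨ ℤ→ℚ-* (+ p) r ⟩
      ℕ→ℚ p * ℤ→ℚ r                 ≡⟨ cong (λ n → ℕ→ℚ n * ℤ→ℚ r) (ℕP.*-identityʳ p) ⟨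
      ℕ→ℚ (p ^ 1) * ℤ→ℚ r           ∎)
    where
    open ≡-Reasoning
    open ℚ-Solver
    j = (n ℤ.* u) ℤ.%ℕ p
    q = (n ℤ.* u) ℤ./ℕ p
    r = q ℤ.* d ℤ.- n ℤ.* v

  divisible-+-complement : ∀ {x j} k → Divisible 1 (x - ℕ→ℚ j) → k ℕ.+ j ≡ p → Divisible 1 (x - ℚ.- ℕ→ℚ k)
  divisible-+-complement {x} {j} k x≡j k+j≡p =
    subst (Divisible 1) x-j+[k+j]≡x+k (divisible-+ x≡j (divisible-ℕ (subst (p ∣_) (sym k+j≡p) ∣-refl)))
    where
    open ℚ-Solver
    x-j+[k+j]≡x+k : x - ℕ→ℚ j + ℕ→ℚ (k ℕ.+ j) ≡ x - ℚ.- ℕ→ℚ k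
    x-j+[k+j]≡x+k = trans (cong (λ y → x - ℕ→ℚ j + y) (ℕ→ℚ-+ k j))
                      (solve 3 (λ x j k → x :- j :+ (k :+ j) := x :- (:- k)) refl x (ℕ→ℚ j) (ℕ→ℚ k))

  residue-below : ∀ {x} → Integral x → ¬ Divisible 1 (x - ℚ.- 1ℚ) → ¬ Divisible 1 (x - ℚ.- ℕ→ℚ 2) →
                  ∃ λ j → 2 ℕ.+ j < p × Divisible 1 (x - ℕ→ℚ j)
  residue-below {x} ix x≢-1 x≢-2 = below (residue ix)
    where
    below : (∃ λ j → j < p × Divisible 1 (x - ℕ→ℚ j)) → ∃ λ j → 2 ℕ.+ j < p × Divisible 1 (x - ℕ→ℚ j)
    below (j , j<p , x≡j) with suc j ℕ.≟ p | 2 ℕ.+ j ℕ.≟ p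
    ... | yes 1+j≡p | _         = ⊥-elim (x≢-1 (divisible-+-complement {x} {j} 1 x≡j 1+j≡p))
    ... | no _      | yes 2+j≡p = ⊥-elim (x≢-2 (divisible-+-complement {x} {j} 2 x≡j 2+j≡p))
    ... | no 1+j≢p  | no 2+j≢p  = j , ℕP.≤∧≢⇒< (ℕP.≤∧≢⇒< j<p 1+j≢p) 2+j≢p , x≡j

  p∤suc : ∀ {k} → suc k < p → p ∤ suc k
  p∤suc k+1<p p∣k+1 = ℕP.<⇒≱ k+1<p (∣⇒≤ p∣k+1)

  integral-1/suc : ∀ {k} → suc k < p → Integral (+ 1 ℚ./ suc k)
  integral-1/suc {k} k+1<p = integral (+ suc k) (+ 1) (p∤suc k+1<p) (ℤ→ℚ-*-/ (+ 1) k)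

  integral-binom : ∀ {x} → Integral x → ∀ k → k < p → Integral (binom x k)
  integral-binom ix zero    _     = integral-ℤ (+ 1)
  integral-binom ix (suc k) k+1<p =
    integral-* (integral-* (integral-binom ix k (ℕP.<-trans (ℕP.n<1+n k) k+1<p)) (integral-- ix (integral-ℤ (+ k))))
               (integral-1/suc k+1<p)

  divisible-binom : ∀ {x j} → Integral x → Divisible 1 (x - ℕ→ℚ j) → ∀ k → j < k → k < p → Divisible 1 (binom x k)
  divisible-binom {x} {j} ix x≡j (suc k) j<k+1 k+1<p with j ℕ.≟ k
  ... | yes refl = divisible-*-integral (integral-*-divisible (integral-binom ix j k<p) x≡j) (integral-1/suc k+1<p)
    where k<p = ℕP.<-trans (ℕP.n<1+n k) k+1<p
  ... | no j≢k  = divisible-*-integral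
      (divisible-*-integral (divisible-binom ix x≡j k (ℕP.≤∧≢⇒< (ℕP.≤-pred j<k+1) j≢k) (ℕP.<-trans (ℕP.n<1+n k) k+1<p))
                            (integral-- ix (integral-ℤ (+ k))))
      (integral-1/suc k+1<p)

  p∤k! : ∀ {k} → k < p → p ∤ k !
  p∤k! {zero}  _     = p∤1
  p∤k! {suc k} k+1<p p∣[k+1]! =
    [ p∤suc k+1<p , p∤k! (ℕP.<-trans (ℕP.n<1+n k) k+1<p) ]′ (euclidsLemma (suc k) (k !) p-prime p∣[k+1]!)

  p∣central-binom : ∀ {k} → p ≤ 2 ℕ.* k → k < p → p ∣ (2 ℕ.* k C k)
  p∣central-binom {k} p≤2k k<p
    with euclidsLemma (2 ℕ.* k C k) (k ! ℕ.* k !) p-prime (subst (p ∣_) (sym ([2kCk]*[k!*k!]≡[2k]! k)) p∣[2k]!)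
    where
    p∣[2k]! : p ∣ (2 ℕ.* k) !
    p∣[2k]! = ∣-trans (n∣n! p) (m≤n⇒m!∣n! p≤2k)
      where n∣n! : ∀ n .{{_ : ℕ.NonZero n}} → n ∣ n !
            n∣n! (suc n) = m∣m*n (n !)
  ... | inj₁ p∣C     = p∣C
  ... | inj₂ p∣k!k! = ⊥-elim ([ p∤k! k<p , p∤k! k<p ]′ (euclidsLemma (k !) (k !) p-prime p∣k!k!))

  divisible-c : ∀ {a j₁ j₂ k} → Integral a → Divisible 1 (a - ℕ→ℚ j₁) → Divisible 1 (ℚ.- 1ℚ - a - ℕ→ℚ j₂) →
                j₁ < k → j₂ < k → p ≤ 2 ℕ.* k → k < p → Divisible 3 (c a k)
  divisible-c ia a≡j₁ b≡j₂ j₁<k j₂<k p≤2k k<p =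
    divisible-* (divisible-* (divisible-binom ia a≡j₁ _ j₁<k k<p)
                             (divisible-binom (integral-- (integral-neg (integral-ℤ (+ 1))) ia) b≡j₂ _ j₂<k k<p))
                (divisible-ℕ (p∣central-binom p≤2k k<p))

-- The congruence

module Congruence {n : ℕ} (p-prime : Prime (3 ℕ.+ n)) (1≤n : 1 ≤ n) {a m : ℚ}
  (a∈ℤₚ : InZp (3 ℕ.+ n) a) (m∈ℤₚ : InZp (3 ℕ.+ n) m) (m≢0 : ¬ CongMod (3 ℕ.+ n) 1 m 0ℚ)
  (a≢0 : ¬ CongMod (3 ℕ.+ n) 1 a 0ℚ) (a≢1 : ¬ CongMod (3 ℕ.+ n) 1 a 1ℚ)
  (a≢-1 : ¬ CongMod (3 ℕ.+ n) 1 a (ℚ.- 1ℚ)) (a≢-2 : ¬ CongMod (3 ℕ.+ n) 1 a (ℚ.- ℕ→ℚ 2)) where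

  open PAdic p-prime

  p≰3 : ¬ 3 ℕ.+ n ≤ 3
  p≰3 p≤3 = ℕP.<⇒≱ 1≤n (ℕP.+-cancelˡ-≤ 3 n 0 p≤3)

  p∤6 : 3 ℕ.+ n ∤ 6
  p∤6 p∣6 = [ (λ p∣2 → p≰3 (ℕP.≤-trans (∣⇒≤ p∣2) (ℕP.n≤1+n 2))) , (λ p∣3 → p≰3 (∣⇒≤ p∣3)) ]′
              (euclidsLemma 2 3 p-prime p∣6)

  p∤3+2n : 3 ℕ.+ n ∤ 3 ℕ.+ 2 ℕ.* n
  p∤3+2n p∣3+2n = p≰3 (∣⇒≤ (∣m+n∣m⇒∣n p∣[3+2n]+3 p∣3+2n))
    where
    p∣[3+2n]+3 : 3 ℕ.+ n ∣ (3 ℕ.+ 2 ℕ.* n) ℕ.+ 3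
    p∣[3+2n]+3 = divides 2 (solve 1 (λ n → con 3 :+ con 2 :* n :+ con 3 := con 2 :* (con 3 :+ n)) refl n)
      where open ℕ-Solver

  p≤2k : ∀ {k} → n < k → 3 ℕ.+ n ≤ 2 ℕ.* k
  p≤2k {k} n<k = subst (3 ℕ.+ n ≤_) (cong (k ℕ.+_) (sym (ℕP.+-identityʳ k))) (ℕP.+-mono-≤ 2≤k n<k)
    where 2≤k = ℕP.≤-trans (s≤s 1≤n) n<k

  a∈ℤₚ′ : Integral a
  a∈ℤₚ′ = InZp⇒integral a∈ℤₚ

  m∈ℤₚ′ : Integral m
  m∈ℤₚ′ = InZp⇒integral m∈ℤₚ

  m-unit : ¬ Divisible 1 m
  m-unit d = ¬CongMod⇒¬divisible {1} {m} {0ℚ} m≢0 (subst (Divisible 1) (sym (ℚP.+-identityʳ m)) d)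

  m≢0′ : m ≢ 0ℚ
  m≢0′ = ¬divisible⇒≢0 m-unit

  open Telescoping a m (term a m) (term-suc a m≢0′) public

  6-unit : ¬ Divisible 1 (ℕ→ℚ 6)
  6-unit = ¬divisible-ℤ {+ 6} p∤6

  a-1-unit : ¬ Divisible 1 (a - 1ℚ)
  a-1-unit = ¬CongMod⇒¬divisible {1} {a} {1ℚ} a≢1

  a+2-unit : ¬ Divisible 1 (a + ℕ→ℚ 2)
  a+2-unit d = ¬CongMod⇒¬divisible {1} {a} {ℚ.- ℕ→ℚ 2} a≢-2
                 (subst (Divisible 1) (solve 1 (λ a → a :+ con (ℕ→ℚ 2) := a :- (:- con (ℕ→ℚ 2))) refl a) d)
    where open ℚ-Solver

  D≢0 : D ≢ 0ℚ
  D≢0 = *-≢0 (*-≢0 (¬divisible⇒≢0 6-unit) (¬divisible⇒≢0 a-1-unit)) (¬divisible⇒≢0 a+2-unit)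

  integral-inv-D : Integral (inv D)
  integral-inv-D =
    integral-inv-* (*-≢0 (¬divisible⇒≢0 6-unit) (¬divisible⇒≢0 a-1-unit)) (¬divisible⇒≢0 a+2-unit)
      (integral-inv-* (¬divisible⇒≢0 6-unit) (¬divisible⇒≢0 a-1-unit)
        (integral-inv (integral-ℕ 6) 6-unit) (integral-inv (integral-- a∈ℤₚ′ (integral-ℕ 1)) a-1-unit))
      (integral-inv (integral-+ a∈ℤₚ′ (integral-ℕ 2)) a+2-unit)

  [-1-a]≢-1 : ¬ Divisible 1 (ℚ.- 1ℚ - a - ℚ.- 1ℚ)
  [-1-a]≢-1 d = ¬CongMod⇒¬divisible {1} {a} {0ℚ} a≢0
             (subst (Divisible 1) (solve 1 (λ a → :- (:- con 1ℚ :- a :- :- con 1ℚ) := a :- con 0ℚ) refl a) (divisible-neg d))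
    where open ℚ-Solver

  [-1-a]≢-2 : ¬ Divisible 1 (ℚ.- 1ℚ - a - ℚ.- ℕ→ℚ 2)
  [-1-a]≢-2 d = ¬CongMod⇒¬divisible {1} {a} {1ℚ} a≢1
             (subst (Divisible 1) (solve 1 (λ a → :- (:- con 1ℚ :- a :- :- con (ℕ→ℚ 2)) := a :- con 1ℚ) refl a) (divisible-neg d))
    where open ℚ-Solver

  divisible-c-near-p : ∀ {k} → n < k → k < 3 ℕ.+ n → Divisible 3 (c a k)
  divisible-c-near-p {k} n<k k<p =
    from-residues (residue-below a∈ℤₚ′ (¬CongMod⇒¬divisible {1} {a} {ℚ.- 1ℚ} a≢-1) (¬CongMod⇒¬divisible {1} {a} {ℚ.- ℕ→ℚ 2} a≢-2))
                  (residue-below b∈ℤₚ [-1-a]≢-1 [-1-a]≢-2)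
    where
    b∈ℤₚ : Integral (ℚ.- 1ℚ - a)
    b∈ℤₚ = integral-- (integral-neg (integral-ℤ (+ 1))) a∈ℤₚ′
    j<k : ∀ {j} → 2 ℕ.+ j < 3 ℕ.+ n → j < k
    j<k {j} 3+j≤3+n = ℕP.≤-<-trans (ℕP.+-cancelˡ-≤ 3 j n 3+j≤3+n) n<k
    from-residues : (∃ λ j → 2 ℕ.+ j < 3 ℕ.+ n × Divisible 1 (a - ℕ→ℚ j)) →
                    (∃ λ j → 2 ℕ.+ j < 3 ℕ.+ n × Divisible 1 (ℚ.- 1ℚ - a - ℕ→ℚ j)) → Divisible 3 (c a k)
    from-residues (j₁ , j₁<p-2 , a≡j₁) (j₂ , j₂<p-2 , b≡j₂) =
      divisible-c a∈ℤₚ′ a≡j₁ b≡j₂ (j<k j₁<p-2) (j<k j₂<p-2) (p≤2k n<k) k<p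

  divisible-term : ∀ {k} → n < k → k < 3 ℕ.+ n → Divisible 3 (term a m k)
  divisible-term {k} n<k k<p =
    divisible-*-integral (divisible-c-near-p n<k k<p) (integral-inv-^ m≢0′ (integral-inv (m∈ℤₚ′) m-unit) k)

  divisible-boundary : Divisible 3 (boundary n)
  divisible-boundary =
    divisible-- (divisible-*-integral (divisible-term (ℕP.m<n⇒m<1+n (ℕP.n<1+n n)) (ℕP.n<1+n (2 ℕ.+ n))) integral-coefficient)
                (integral-*-divisible (integral-* (integral-ℤ (+ 6)) (integral-ℤ (+ n))) (divisible-term (ℕP.n<1+n n) (ℕP.m<n⇒m<1+n (ℕP.n<1+n (1 ℕ.+ n)))))
    where
    integral-inv-2n+3 : Integral (inv (ℕ→ℚ 2 * ℕ→ℚ n + ℕ→ℚ 3))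
    integral-inv-2n+3 = subst (λ x → Integral (inv x)) (ℕ→ℚ-3+2n n) (integral-inv (integral-ℕ (3 ℕ.+ 2 ℕ.* n)) (¬divisible-ℤ {+ (3 ℕ.+ 2 ℕ.* n)} p∤3+2n))
    integral-coefficient : Integral (ℚ.- (ℕ→ℚ 2 * (ℕ→ℚ 2 * ℕ→ℚ n + 1ℚ))
                                     + m * (ℕ→ℚ 3 * ℕ→ℚ n * ℕ→ℚ n + ℕ→ℚ 9 * ℕ→ℚ n + ℕ→ℚ 7) * inv (ℕ→ℚ 2 * ℕ→ℚ n + ℕ→ℚ 3))
    integral-coefficient =
      integral-+ (integral-neg (integral-* (integral-ℕ 2) (integral-+ (integral-* (integral-ℕ 2) (integral-ℕ n)) (integral-ℕ 1))))
                 (integral-* (integral-* (m∈ℤₚ′)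
                                         (integral-+ (integral-+ (integral-* (integral-* (integral-ℕ 3) (integral-ℕ n)) (integral-ℕ n)) (integral-* (integral-ℕ 9) (integral-ℕ n))) (integral-ℕ 7)))
                             integral-inv-2n+3)

  lhs rhs : ℚ
  lhs = sumTo n (λ k → c a k * inv ((m ^ℚ k) * ℕ→ℚ (k ℕ.+ 2)))
  rhs = (ℕ→ℚ 4 - m) * inv D * sumTo (2 ℕ.+ n) (λ k → ℕ→ℚ k * c a k * inv (m ^ℚ k))
      + (m - ℕ→ℚ 6) * inv D * sumTo (2 ℕ.+ n) (λ k → c a k * inv (m ^ℚ k))
      + E * inv D * sumTo (1 ℕ.+ n) (λ k → c a k * inv ((m ^ℚ k) * ℕ→ℚ (suc k)))

  lhs-rhs≡inv[D]*defect : lhs - rhs ≡ inv D * defect n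
  lhs-rhs≡inv[D]*defect = begin
    lhs - rhs
      ≡⟨ cong₂ (λ x y → x - ((ℕ→ℚ 4 - m) * inv D * y + (m - ℕ→ℚ 6) * inv D * B + E * inv D * C))
               (sumTo-cong n L≗) (sumTo-cong (2 ℕ.+ n) A≗) ⟩
    L′ - ((ℕ→ℚ 4 - m) * inv D * A′ + (m - ℕ→ℚ 6) * inv D * B + E * inv D * C)
      ≡⟨ cong (λ z → L′ - ((ℕ→ℚ 4 - m) * inv D * A′ + (m - ℕ→ℚ 6) * inv D * B + E * inv D * z)) (sumTo-cong (1 ℕ.+ n) C≗) ⟩
    L′ - ((ℕ→ℚ 4 - m) * inv D * A′ + (m - ℕ→ℚ 6) * inv D * B + E * inv D * C′)
      ≡⟨ factor-inv D≢0 L′ (ℕ→ℚ 4 - m) A′ (m - ℕ→ℚ 6) B E C′ ⟩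
    inv D * defect n ∎
    where
    open ≡-Reasoning
    B  = sumTo (2 ℕ.+ n) (term a m)
    C  = sumTo (1 ℕ.+ n) (λ k → c a k * inv ((m ^ℚ k) * ℕ→ℚ (suc k)))
    L′ = sumTo n t/[2+k]
    A′ = sumTo (2 ℕ.+ n) k*t
    C′ = sumTo (1 ℕ.+ n) t/[1+k]
    L≗ : ∀ k → c a k * inv ((m ^ℚ k) * ℕ→ℚ (k ℕ.+ 2)) ≡ t/[2+k] k
    L≗ k = trans (cong (λ i → c a k * inv ((m ^ℚ k) * ℕ→ℚ i)) (ℕP.+-comm k 2))
                 (*-inv-*-assoc (c a k) (^ℚ-≢0 m≢0′ k) (ℕ→ℚ-suc≢0 (1 ℕ.+ k)))
    A≗ : ∀ k → ℕ→ℚ k * c a k * inv (m ^ℚ k) ≡ k*t k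
    A≗ k = ℚP.*-assoc (ℕ→ℚ k) (c a k) (inv (m ^ℚ k))
    C≗ : ∀ k → c a k * inv ((m ^ℚ k) * ℕ→ℚ (suc k)) ≡ t/[1+k] k
    C≗ k = *-inv-*-assoc (c a k) (^ℚ-≢0 m≢0′ k) (ℕ→ℚ-suc≢0 k)

theorem6p1 : (p : ℕ) → Prime p → 3 < p → (a m : ℚ) → InZp p a → InZp p m
  → ¬ CongMod p 1 m 0ℚ
  → ¬ CongMod p 1 a 0ℚ → ¬ CongMod p 1 a 1ℚ → ¬ CongMod p 1 a (ℚ.- 1ℚ)
  → ¬ CongMod p 1 a (ℚ.- ℕ→ℚ 2)
  → CongMod p 3
      (sumTo (p ∸ 3) (λ k → c a k * inv ((m ^ℚ k) * ℕ→ℚ (k ℕ.+ 2))))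
      ((ℕ→ℚ 4 - m) * inv (ℕ→ℚ 6 * (a - 1ℚ) * (a + ℕ→ℚ 2))
         * sumTo (p ∸ 1) (λ k → ℕ→ℚ k * c a k * inv (m ^ℚ k))
       + (m - ℕ→ℚ 6) * inv (ℕ→ℚ 6 * (a - 1ℚ) * (a + ℕ→ℚ 2))
         * sumTo (p ∸ 1) (λ k → c a k * inv (m ^ℚ k))
       + (ℕ→ℚ 2 * a * (a + 1ℚ) - m) * inv (ℕ→ℚ 6 * (a - 1ℚ) * (a + ℕ→ℚ 2))
         * sumTo (p ∸ 2) (λ k → c a k * inv ((m ^ℚ k) * ℕ→ℚ (suc k))))
theorem6p1 zero                _ ()
theorem6p1 (suc zero)          _ (s≤s ())
theorem6p1 (suc (suc zero))    _ (s≤s (s≤s ()))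
theorem6p1 (suc (suc (suc n))) p-prime (s≤s (s≤s (s≤s 1≤n))) a m a∈ℤₚ m∈ℤₚ m≢0 a≢0 a≢1 a≢-1 a≢-2 =
  divisible⇒CongMod {3} {lhs} {rhs}
    (subst (Divisible 3) (sym lhs-rhs≡inv[D]*defect)
      (integral-*-divisible integral-inv-D
        (subst (Divisible 3) (sym (defect≡boundary n)) divisible-boundary)))
  where
  open PAdic p-prime
  open Congruence p-prime 1≤n {a} {m} a∈ℤₚ m∈ℤₚ m≢0 a≢0 a≢1 a≢-1 a≢-2
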